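{- For every $k\ge1$ and every function $F:\{0,1\}^n\times\{0,1\}^n\to\{0,1\}$, $\mathsf{NM}_k(F)\ge \mathsf{D}(F)/k$.
   Context: $\mathsf{D}(F)$ is the standard deterministic (two-way) communication complexity of $F$: the minimum, over deterministic protocols in which Alice (holding $x$) and Bob (holding $y$) exchange bits and then output $F(x,y)$, of the total number of bits exchanged on the worst-case input. $\mathsf{NM}_k(F)$ is the memoryless communication complexity restricted to at most $k$ rounds: an $s$-bit memoryless protocol consists of functions $f_x:\{0,1\}^s\to\{0,1\}^s$ and $g_y:\{0,1\}^s\to\{0,1\}^s$; Alice first sends $f_x(0^s)$, thereafter whenever Bob receives $m$ he replies $g_y(m)$ and whenever Alice receives $m$ she replies $f_x(m)$; the protocol terminates as soon as a message $1^{s-1}b$ is sent, with output $b$. $\mathsf{NM}_k(F)$ is the least $s$ for which there is such a protocol that, on every input $(x,y)$, terminates with output $F(x,y)$ after at most $k$ messages. -}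

module Defs where

open import Data.Bool using (Bool; true; false; if_then_else_)
open import Data.Nat using (ℕ; zero; suc; _≤_; _<_; _⊔_)
open import Data.Vec using (Vec; replicate; _∷ʳ_)
open import Data.Empty using (⊥)
open import Data.Product using (Σ; ∃; _×_; _,_)
open import Relation.Binary.PropositionalEquality using (_≡_; _≢_)

Bits : ℕ → Set
Bits n = Vec Bool n

-- Each internal node is owned by Alice or Bob, who sends one bit that
-- depends only on her/his own input; the bit selects the subtree
-- (false = left, true = right).  Leaves carry the output.
data Protocol (X Y : Set) : Set where
  leaf  : Bool → Protocol X Y
  alice : (X → Bool) → Protocol X Y → Protocol X Y → Protocol X Y
  bob   : (Y → Bool) → Protocol X Y → Protocol X Y → Protocol X Y

cost : ∀ {X Y} → Protocol X Y → ℕ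
cost (leaf _)      = 0
cost (alice _ l r) = suc (cost l ⊔ cost r)
cost (bob _ l r)   = suc (cost l ⊔ cost r)

run : ∀ {X Y} → Protocol X Y → X → Y → Bool
run (leaf b)      x y = b
run (alice a l r) x y = if a x then run r x y else run l x y
run (bob c l r)   x y = if c y then run r x y else run l x y

DAtMost : ∀ {n} → (Bits n → Bits n → Bool) → ℕ → Set
DAtMost {n} F c =
  Σ (Protocol (Bits n) (Bits n)) λ P →
    (cost P ≤ c) × (∀ x y → run P x y ≡ F x y)

termMsg : (t : ℕ) → Bool → Bits (suc t)
termMsg t b = replicate t true ∷ʳ b

-- msgs f g m i : the (i+1)-th message when the next speaker uses f,
-- the other speaker uses g, and the last received message is m.
msgs : ∀ {s} → (Bits s → Bits s) → (Bits s → Bits s) → Bits s → ℕ → Bits s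
msgs f g m zero    = f m
msgs f g m (suc i) = msgs g f (f m) i

TerminatesWith : (t : ℕ) → (Bits (suc t) → Bits (suc t)) → (Bits (suc t) → Bits (suc t))
               → ℕ → Bool → Set
TerminatesWith t fx gy k b =
  Σ ℕ λ j → (j < k)
          × (msgs fx gy (replicate (suc t) false) j ≡ termMsg t b)
          × (∀ i → i < j → ∀ b′ → msgs fx gy (replicate (suc t) false) i ≢ termMsg t b′)

-- NM_k(F) ≤ s (with s = suc t ≥ 1): there is an s-bit memoryless
-- protocol (f_x)_x, (g_y)_y that on every input (x,y) terminates with
-- output F(x,y) after at most k messages.
NMAtMost : ∀ {n} → ℕ → (Bits n → Bits n → Bool) → ℕ → Set
NMAtMost k F zero = ⊥
NMAtMost {n} k F (suc t) =
  Σ (Bits n → Bits (suc t) → Bits (suc t)) λ f →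
  Σ (Bits n → Bits (suc t) → Bits (suc t)) λ g →
    ∀ x y → TerminatesWith t (f x) (g y) k (F x y)

module Submission where

-- A memoryless protocol that sends s-bit messages and always stops within
-- k messages can be simulated by an ordinary deterministic protocol of
-- cost k·s, hence NM_k(F) ≥ D(F)/k.
--
-- The simulation replays the memoryless conversation message by message.
-- The speaker of the current message knows its content (it depends only on
-- her own input and on the previous message, which both parties know), so
-- she transmits it bit by bit along a protocol tree of depth s (`send`).
-- Once a message has been transmitted, both parties check whether it is a
-- terminating message 1^{s-1}b; if so the tree ends in a leaf labelled b,
-- otherwise the roles swap and the next message is simulated (`resolve`,
-- `simulate`).  Each round costs s bits, so k rounds cost k·s
-- (`simulate-cost`), and whenever the memoryless conversation first
-- terminates at message j < k with output b, the simulation outputs b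
-- (`simulate-correct`).

open import Defs
open import Function using (_∘_)
open import Data.Bool using (Bool; true; false)
open import Data.Bool.Properties using () renaming (_≟_ to _≟ᴮ_)
open import Data.Nat using (ℕ; _≤_; _<_; _*_; _+_; zero; suc; s≤s; z≤n)
open import Data.Nat.Properties using (⊔-lub; ≤-refl; ≤-trans)
open import Data.Vec using (Vec; []; _∷_; head; tail; last; replicate)
open import Data.Vec.Properties using (≡-dec; last-∷ʳ)
open import Data.Product using (_×_; _,_)
open import Data.Empty using (⊥-elim)
open import Relation.Nullary using (yes; no)
open import Relation.Binary.PropositionalEquality using (_≡_; _≢_; refl; sym; cong; module ≡-Reasoning)

open ≡-Reasoning

head-∷-tail : ∀ {A : Set} {n} (v : Vec A (suc n)) → head v ∷ tail v ≡ v
head-∷-tail (_ ∷ _) = refl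

last-termMsg : ∀ t b → last (termMsg t b) ≡ b
last-termMsg t b = last-∷ʳ b (replicate t true)

module Speakers {X Y : Set} where

  data Speaker : Set where
    Alice Bob : Speaker

  Input : Speaker → Set
  Input Alice = X
  Input Bob   = Y

  input : (p : Speaker) → X → Y → Input p
  input Alice x y = x
  input Bob   x y = y

  node : (p : Speaker) → (Input p → Bool) → Protocol X Y → Protocol X Y → Protocol X Y
  node Alice = alice
  node Bob   = bob

  run-node : ∀ p (a : Input p → Bool) (k : Bool → Protocol X Y) x y →
             run (node p a (k false) (k true)) x y ≡ run (k (a (input p x y))) x y
  run-node Alice a k x y with a x
  ... | false = refl
  ... | true  = refl
  run-node Bob a k x y with a y
  ... | false = refl
  ... | true  = refl

  node-cost : ∀ p a {l r : Protocol X Y} {c} →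
              cost l ≤ c → cost r ≤ c → cost (node p a l r) ≤ suc c
  node-cost Alice a l≤c r≤c = s≤s (⊔-lub l≤c r≤c)
  node-cost Bob   a l≤c r≤c = s≤s (⊔-lub l≤c r≤c)

  send : (p : Speaker) (s : ℕ) → (Input p → Bits s) → (Bits s → Protocol X Y) → Protocol X Y
  send p zero    h c = c []
  send p (suc s) h c = node p (head ∘ h) (branch false) (branch true)
    where
    branch : Bool → Protocol X Y
    branch b = send p s (tail ∘ h) (c ∘ (b ∷_))

  send-run : ∀ p s h c x y → run (send p s h c) x y ≡ run (c (h (input p x y))) x y
  send-run p zero h c x y with h (input p x y)
  ... | [] = refl
  send-run p (suc s) h c x y = begin
      run (send p (suc s) h c) x y
    ≡⟨ run-node p (head ∘ h) (λ b → send p s (tail ∘ h) (c ∘ (b ∷_))) x y ⟩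
      run (send p s (tail ∘ h) (c ∘ (head v ∷_))) x y
    ≡⟨ send-run p s (tail ∘ h) (c ∘ (head v ∷_)) x y ⟩
      run (c (head v ∷ tail v)) x y
    ≡⟨ cong (λ w → run (c w) x y) (head-∷-tail v) ⟩
      run (c v) x y
    ∎
    where v = h (input p x y)

  send-cost : ∀ p s h c b → (∀ v → cost (c v) ≤ b) → cost (send p s h c) ≤ s + b
  send-cost p zero    h c b c≤b = c≤b []
  send-cost p (suc s) h c b c≤b = node-cost p (head ∘ h)
    (send-cost p s (tail ∘ h) (c ∘ (false ∷_)) b (c≤b ∘ (false ∷_)))
    (send-cost p s (tail ∘ h) (c ∘ (true ∷_))  b (c≤b ∘ (true ∷_)))

module Simulation {X Y : Set} (t : ℕ)
                  (f : X → Bits (suc t) → Bits (suc t))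
                  (g : Y → Bits (suc t) → Bits (suc t)) where

  open Speakers {X} {Y}

  Msg : Set
  Msg = Bits (suc t)

  -- Once a message m is known to both parties: stop with output b if m is
  -- the terminating message 1^t b (then b is the last bit of m), otherwise
  -- continue with p.
  resolve : Msg → Protocol X Y → Protocol X Y
  resolve m p with ≡-dec _≟ᴮ_ m (termMsg t (last m))
  ... | yes _ = leaf (last m)
  ... | no  _ = p

  resolve-cost : ∀ m p → cost (resolve m p) ≤ cost p
  resolve-cost m p with ≡-dec _≟ᴮ_ m (termMsg t (last m))
  ... | yes _ = z≤n
  ... | no  _ = ≤-refl

  resolve-terminal : ∀ b p x y → run (resolve (termMsg t b) p) x y ≡ b
  resolve-terminal b p x y with ≡-dec _≟ᴮ_ (termMsg t b) (termMsg t (last (termMsg t b)))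
  ... | yes _   = last-termMsg t b
  ... | no  ¬eq = ⊥-elim (¬eq (sym (cong (termMsg t) (last-termMsg t b))))

  resolve-nonterminal : ∀ m p → (∀ b → m ≢ termMsg t b) → resolve m p ≡ p
  resolve-nonterminal m p nonterm with ≡-dec _≟ᴮ_ m (termMsg t (last m))
  ... | yes eq = ⊥-elim (nonterm (last m) eq)
  ... | no  _  = refl

  respond : (p : Speaker) → Input p → Msg → Msg
  respond Alice = f
  respond Bob   = g

  simulate : Speaker → Speaker → ℕ → Msg → Protocol X Y
  simulate p q zero    m = leaf false
  simulate p q (suc r) m =
    send p (suc t) (λ z → respond p z m) (λ m′ → resolve m′ (simulate q p r m′))

  simulate-cost : ∀ p q r m → cost (simulate p q r m) ≤ r * suc t
  simulate-cost p q zero    m = z≤n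
  simulate-cost p q (suc r) m = send-cost p (suc t) (λ z → respond p z m) _ (r * suc t)
    (λ m′ → ≤-trans (resolve-cost m′ _) (simulate-cost q p r m′))

  FirstTerminalAt : (u v : Msg → Msg) → Msg → ℕ → Bool → Set
  FirstTerminalAt u v m j b =
    (msgs u v m j ≡ termMsg t b) × (∀ i → i < j → ∀ b′ → msgs u v m i ≢ termMsg t b′)

  module _ (x : X) (y : Y) where

    reply : (p : Speaker) → Msg → Msg
    reply p = respond p (input p x y)

    simulate-step : ∀ p q r m →
      run (simulate p q (suc r) m) x y ≡
      run (resolve (reply p m) (simulate q p r (reply p m))) x y
    simulate-step p q r m =
      send-run p (suc t) (λ z → respond p z m) (λ m′ → resolve m′ (simulate q p r m′)) x y

    simulate-correct : ∀ p q j r m b → j < r →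
      FirstTerminalAt (reply p) (reply q) m j b → run (simulate p q r m) x y ≡ b
    simulate-correct p q zero (suc r) m b _ (terminal , _) = begin
        run (simulate p q (suc r) m) x y
      ≡⟨ simulate-step p q r m ⟩
        run (resolve (reply p m) (simulate q p r (reply p m))) x y
      ≡⟨ cong (λ m′ → run (resolve m′ (simulate q p r (reply p m))) x y) terminal ⟩
        run (resolve (termMsg t b) (simulate q p r (reply p m))) x y
      ≡⟨ resolve-terminal b _ x y ⟩
        b
      ∎
    simulate-correct p q (suc j) (suc r) m b (s≤s j<r) (terminal , earlier) = begin
        run (simulate p q (suc r) m) x y
      ≡⟨ simulate-step p q r m ⟩
        run (resolve (reply p m) (simulate q p r (reply p m))) x y
      ≡⟨ cong (λ P → run P x y) (resolve-nonterminal _ _ (earlier 0 (s≤s z≤n))) ⟩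
        run (simulate q p r (reply p m)) x y
      ≡⟨ simulate-correct q p j r (reply p m) b j<r
           (terminal , λ i i<j → earlier (suc i) (s≤s i<j)) ⟩
        b
      ∎

fact4p11 : (n k : ℕ) → 1 ≤ k → (F : Bits n → Bits n → Bool) →
    ∀ s → NMAtMost k F s → DAtMost F (k * s)
fact4p11 n k _ F zero ()
fact4p11 n k _ F (suc t) (f , g , terminates) =
  simulate Alice Bob k start , simulate-cost Alice Bob k start , correct
  where
  open Simulation t f g
  open Speakers

  start : Bits (suc t)
  start = replicate (suc t) false

  correct : ∀ x y → run (simulate Alice Bob k start) x y ≡ F x y
  correct x y with terminates x y
  ... | j , j<k , firstTerminal = simulate-correct x y Alice Bob j k start (F x y) j<k firstTerminal
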